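{- Let $t\ge3$ be an integer and let $\lambda\in\mathcal{DS}(t)$ satisfy $|\lambda|=\max\{|\mu|:\mu\in\mathcal{DS}(t)\}$. Then $2t-1\in MD(\lambda)$, and $1,3,2t-3\notin MD(\lambda)$.
   Context: Hook length of box $(i,j)$ of a Young diagram: number of boxes to its right in row $i$, plus number below it in column $j$, plus one. A partition is a $t$-core if no hook length is divisible by $t$; a $(t,t+1)$-core if it is both a $t$-core and a $(t+1)$-core. Self-conjugate: Young diagram symmetric about the main diagonal. $|\lambda|$ is the sum of the parts. $s(\lambda)$ is the largest $s$ such that $\lambda$ has at least $s$ parts $\ge s$. $MD(\lambda)$ is the set of hook lengths of the main-diagonal boxes $(i,i)$, $1\le i\le s(\lambda)$. $\mathcal{DS}(t)$ is the set of self-conjugate $(t,t+1)$-core partitions whose first $s(\lambda)$ parts are pairwise distinct, including the empty partition. -}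

module Defs where

open import Data.Nat using (ℕ; zero; suc; _+_; _∸_; _≤_; _<_; _≥_; _≤?_)
open import Data.Nat.Divisibility using (_∣_)
open import Data.List using (List; []; _∷_; length; filter)
open import Data.Nat.ListAction using (sum)
open import Data.List.Relation.Unary.All using (All)
open import Data.List.Relation.Unary.Linked using (Linked)
open import Data.Product using (_×_; ∃-syntax)
open import Relation.Nullary using (¬_; yes; no)
open import Relation.Binary.PropositionalEquality using (_≡_; _≢_)

IsPartition : List ℕ → Set
IsPartition λ′ = Linked _≥_ λ′ × All (1 ≤_) λ′

-- part λ i = λ_{i+1}  (rows are 0-indexed here), 0 beyond the length
part : List ℕ → ℕ → ℕ
part []       _       = 0
part (x ∷ _)  zero    = x
part (_ ∷ xs) (suc i) = part xs i

countGE : List ℕ → ℕ → ℕ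
countGE λ′ s = length (filter (s ≤?_) λ′)

-- conjugate part (0-indexed column j): λ'_{j+1} = number of parts ≥ j+1
conjPart : List ℕ → ℕ → ℕ
conjPart λ′ j = countGE λ′ (suc j)

size : List ℕ → ℕ
size = sum

InDiagram : List ℕ → ℕ → ℕ → Set
InDiagram λ′ i j = j < part λ′ i

-- hook length of box (i,j): arm + leg + 1
hook : List ℕ → ℕ → ℕ → ℕ
hook λ′ i j = (part λ′ i ∸ suc j) + (conjPart λ′ j ∸ suc i) + 1

IsCore : ℕ → List ℕ → Set
IsCore t λ′ = ∀ i j → InDiagram λ′ i j → ¬ (t ∣ hook λ′ i j)

IsSelfConjugate : List ℕ → Set
IsSelfConjugate λ′ = ∀ j → conjPart λ′ j ≡ part λ′ j

-- s(λ): the largest s ≤ n with at least s parts ≥ s (search downward from n)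
largestSFrom : List ℕ → ℕ → ℕ
largestSFrom λ′ zero = 0
largestSFrom λ′ (suc n) with suc n ≤? countGE λ′ (suc n)
... | yes _ = suc n
... | no  _ = largestSFrom λ′ n

-- s can never exceed the number of parts, so searching from length λ suffices
durfee : List ℕ → ℕ
durfee λ′ = largestSFrom λ′ (length λ′)

InMD : List ℕ → ℕ → Set
InMD λ′ h = ∃[ i ] (i < durfee λ′ × hook λ′ i i ≡ h)

FirstPartsDistinct : List ℕ → Set
FirstPartsDistinct λ′ = ∀ i k → i < k → k < durfee λ′ → part λ′ i ≢ part λ′ k

InDS : ℕ → List ℕ → Set
InDS t λ′ = IsPartition λ′ × IsSelfConjugate λ′ × IsCore t λ′ × IsCore (suc t) λ′
            × FirstPartsDistinct λ′

-- A self-conjugate partition is determined by the arm lengths a₀ > a₁ > ⋯ of its diagonal boxes (its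
-- Frobenius coordinates (a | a)); its size is Σ (2aᵢ + 1) and MD(λ) = {2aᵢ + 1}. The first s(λ) parts are
-- distinct iff consecutive arms differ by at least 2. For such arms the first-row hook lengths are the
-- a₀ + aⱼ + 1 together with numbers ≤ a₀ among which no two consecutive values are both missing, while the
-- boxes off the first row and column carry the hooks of the partition with arms a₁, a₂, …. So λ is a
-- (t, t+1)-core iff every arm is < t and no aᵢ + aⱼ + 1 (i ≤ j) equals t or t + 1.
-- If t − 1 were not an arm of a maximal λ, adding it (and deleting the arms 0, 1, or replacing the arm
-- t − 2 and deleting 0) would give a larger element of DS(t). Hence t − 1 is the largest arm, which rules
-- out the arms 0 and 1 (as t − 1 + 0 + 1 = t and t − 1 + 1 + 1 = t + 1) and, by the gap condition, t − 2.
module Submission where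

open import Defs
open import Data.Nat
open import Data.Nat.Properties
open import Data.Nat.Tactic.RingSolver using (solve-∀)
open import Data.Nat.Divisibility using (_∣_; divides; ∣-refl)
open import Data.Nat.ListAction using (sum)
open import Data.Nat.ListAction.Properties using (sum-++)
open import Data.List using (List; []; _∷_; length; filter; map; replicate; _++_)
open import Data.List.Properties
  using (length-map; length-replicate; length-++; filter-accept; filter-reject; filter-all; filter-none; filter-++)
open import Data.List.Membership.Propositional using (_∈_; _∉_)
open import Data.List.Membership.DecPropositional _≟_ using (_∈?_)
open import Data.List.Relation.Unary.All as All using (All; []; _∷_)
open import Data.List.Relation.Unary.All.Properties using (++⁺; map⁺; replicate⁺; all-filter)
import Data.List.Relation.Unary.All.Properties as All
open import Data.List.Relation.Unary.AllPairs as AllPairs using (AllPairs; []; _∷_)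
import Data.List.Relation.Unary.AllPairs.Properties as AllPairs
open import Data.List.Relation.Unary.Any as Any using (Any; here; there)
open import Data.List.Relation.Unary.Linked as Linked using (Linked; []; [-]; _∷_)
open import Data.List.Relation.Unary.Linked.Properties using (Linked⇒All)
open import Data.Product using (∃-syntax; _×_; _,_; proj₁; proj₂)
open import Data.Sum using (_⊎_; inj₁; inj₂)
import Data.Sum as Sum
open import Data.Unit using (⊤; tt)
open import Data.Bool using (true; false)
open import Function using (id; _∘_; _⇔_; mk⇔; Equivalence)
open import Relation.Nullary using (¬_; yes; no; does; contradiction)
open import Relation.Unary using (Decidable)
open import Relation.Binary.PropositionalEquality
open import Relation.Binary.Definitions using (tri<; tri≈; tri>)

countGE-accept : ∀ {s x} xs → s ≤ x → countGE (x ∷ xs) s ≡ suc (countGE xs s)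
countGE-accept {s} xs s≤x = cong length (filter-accept (s ≤?_) {xs = xs} s≤x)

countGE-reject : ∀ {s x} xs → s ≰ x → countGE (x ∷ xs) s ≡ countGE xs s
countGE-reject {s} xs s≰x = cong length (filter-reject (s ≤?_) {xs = xs} s≰x)

countGE-++ : ∀ xs ys s → countGE (xs ++ ys) s ≡ countGE xs s + countGE ys s
countGE-++ xs ys s = trans (cong length (filter-++ (s ≤?_) xs ys)) (length-++ (filter (s ≤?_) xs))

countGE-all≥ : ∀ {s xs} → All (s ≤_) xs → countGE xs s ≡ length xs
countGE-all≥ {s} ps = cong length (filter-all (s ≤?_) ps)

countGE-all< : ∀ {s xs} → All (_< s) xs → countGE xs s ≡ 0
countGE-all< {s} ps = cong length (filter-none (s ≤?_) (All.map <⇒≱ ps))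

countGE-map-suc : ∀ xs s → countGE (map suc xs) (suc s) ≡ countGE xs s
countGE-map-suc [] s = refl
countGE-map-suc (x ∷ xs) s with s ≤? x
... | yes s≤x = begin
  countGE (suc x ∷ map suc xs) (suc s)  ≡⟨ countGE-accept (map suc xs) (s≤s s≤x) ⟩
  suc (countGE (map suc xs) (suc s))    ≡⟨ cong suc (countGE-map-suc xs s) ⟩
  suc (countGE xs s)                    ≡⟨ countGE-accept xs s≤x ⟨
  countGE (x ∷ xs) s                    ∎
  where open ≡-Reasoning
... | no s≰x = begin
  countGE (suc x ∷ map suc xs) (suc s)  ≡⟨ countGE-reject (map suc xs) (s≰x ∘ s≤s⁻¹) ⟩
  countGE (map suc xs) (suc s)          ≡⟨ countGE-map-suc xs s ⟩
  countGE xs s                          ≡⟨ countGE-reject xs s≰x ⟨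
  countGE (x ∷ xs) s                    ∎
  where open ≡-Reasoning

part-++ˡ : ∀ xs ys {i} → i < length xs → part (xs ++ ys) i ≡ part xs i
part-++ˡ (x ∷ xs) ys {zero}  _ = refl
part-++ˡ (x ∷ xs) ys {suc i} i<n = part-++ˡ xs ys (s≤s⁻¹ i<n)

part-++ʳ : ∀ xs ys i → part (xs ++ ys) (length xs + i) ≡ part ys i
part-++ʳ []       ys i = refl
part-++ʳ (x ∷ xs) ys i = part-++ʳ xs ys i

part-map-suc : ∀ xs {i} → i < length xs → part (map suc xs) i ≡ suc (part xs i)
part-map-suc (x ∷ xs) {zero}  _ = refl
part-map-suc (x ∷ xs) {suc i} i<n = part-map-suc xs (s≤s⁻¹ i<n)

part-replicate : ∀ k v {i} → i < k → part (replicate k v) i ≡ v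
part-replicate (suc k) v {zero}  _ = refl
part-replicate (suc k) v {suc i} i<k = part-replicate k v (s≤s⁻¹ i<k)

part-≥length : ∀ xs {i} → length xs ≤ i → part xs i ≡ 0
part-≥length []       _ = refl
part-≥length (x ∷ xs) {suc i} n≤i = part-≥length xs (s≤s⁻¹ n≤i)

part>0⇒<length : ∀ xs {i} → 0 < part xs i → i < length xs
part>0⇒<length xs {i} 0<p with i <? length xs
... | yes i<n = i<n
... | no  i≮n = contradiction (part-≥length xs (≮⇒≥ i≮n)) (≢-sym (<⇒≢ 0<p))

sorted-bounded : ∀ {x xs} → Linked _≥_ (x ∷ xs) → All (_≤ x) xs
sorted-bounded sorted = All.tail (Linked⇒All (λ y≤x z≤y → ≤-trans z≤y y≤x) ≤-refl sorted)

part-bounded : ∀ {b xs} → All (_≤ b) xs → ∀ j → part xs j ≤ b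
part-bounded []       _       = z≤n
part-bounded (p ∷ _)  zero    = p
part-bounded (_ ∷ ps) (suc j) = part-bounded ps j

part-antitone : ∀ {xs} → Linked _≥_ xs → ∀ {i j} → i ≤ j → part xs j ≤ part xs i
part-antitone {[]}     _      _                     = z≤n
part-antitone {x ∷ xs} sorted {zero}  {zero}  _     = ≤-refl
part-antitone {x ∷ xs} sorted {zero}  {suc j} _     = part-bounded (sorted-bounded sorted) j
part-antitone {x ∷ xs} sorted {suc i} {suc j} i≤j = part-antitone (Linked.tail sorted) (s≤s⁻¹ i≤j)

≤part⇒<countGE : ∀ {xs} → Linked _≥_ xs → ∀ {s} m → suc s ≤ part xs m → m < countGE xs (suc s)
≤part⇒<countGE {x ∷ xs} sorted zero    s+1≤x = subst (0 <_) (sym (countGE-accept xs s+1≤x)) z<s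
≤part⇒<countGE {x ∷ xs} sorted (suc m) s+1≤p  =
  subst (suc m <_) (sym (countGE-accept xs (≤-trans s+1≤p (part-antitone sorted {0} {suc m} z≤n))))
    (s≤s (≤part⇒<countGE (Linked.tail sorted) m s+1≤p))

<countGE⇒≤part : ∀ {xs} → Linked _≥_ xs → ∀ {s} m → m < countGE xs (suc s) → suc s ≤ part xs m
<countGE⇒≤part {x ∷ xs} sorted {s} m m<c with suc s ≤? x
... | no s+1≰x = contradiction (subst (m <_) countGE≡0 m<c) n≮0
  where
  x<s+1 = ≰⇒> s+1≰x
  countGE≡0 : countGE (x ∷ xs) (suc s) ≡ 0
  countGE≡0 = countGE-all< (x<s+1 ∷ All.map (λ y≤x → ≤-<-trans y≤x x<s+1) (sorted-bounded sorted))
<countGE⇒≤part {x ∷ xs} sorted zero    _   | yes s+1≤x = s+1≤x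
<countGE⇒≤part {x ∷ xs} sorted (suc m) m<c | yes s+1≤x =
  <countGE⇒≤part (Linked.tail sorted) m (s≤s⁻¹ (subst (suc m <_) (countGE-accept xs s+1≤x) m<c))

hook-positive : ∀ μ i j → 0 < hook μ i j
hook-positive μ i j = subst (0 <_) (+-comm 1 _) z<s

hook-selfConjugate : ∀ μ → IsSelfConjugate μ → ∀ i j →
                     hook μ i j ≡ (part μ i ∸ suc j) + (part μ j ∸ suc i) + 1
hook-selfConjugate μ sc i j = cong (λ c → (part μ i ∸ suc j) + (c ∸ suc i) + 1) (sc j)

hook-sym : ∀ μ → IsSelfConjugate μ → ∀ i j → hook μ i j ≡ hook μ j i
hook-sym μ sc i j = begin
  hook μ i j                                   ≡⟨ hook-selfConjugate μ sc i j ⟩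
  (part μ i ∸ suc j) + (part μ j ∸ suc i) + 1  ≡⟨ cong (_+ 1) (+-comm (part μ i ∸ suc j) _) ⟩
  (part μ j ∸ suc i) + (part μ i ∸ suc j) + 1  ≡⟨ hook-selfConjugate μ sc j i ⟨
  hook μ j i                                   ∎
  where open ≡-Reasoning

InDiagram-sym : ∀ {μ} → IsPartition μ → IsSelfConjugate μ → ∀ {i j} → InDiagram μ i j → InDiagram μ j i
InDiagram-sym (sorted , _) sc {i} {j} j<μᵢ = <countGE⇒≤part sorted j (subst (j <_) (sym (sc i)) j<μᵢ)

largestSFrom-unique : ∀ {μ d} → Linked _≥_ μ → (∀ m → m < d → suc m ≤ part μ m) → part μ d ≤ d →
                      ∀ n → d ≤ n → largestSFrom μ n ≡ d
largestSFrom-unique _ _ _ zero z≤n = refl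
largestSFrom-unique {μ} {d} sorted below above (suc n) d≤n+1 with suc n ≤? countGE μ (suc n) | m≤n⇒m<n∨m≡n d≤n+1
... | yes _   | inj₂ d≡n+1 = sym d≡n+1
... | yes n<c | inj₁ d<n+1 =
  contradiction (≤-trans (part-antitone sorted d≤n) (≤-trans above d≤n)) (<⇒≱ (<countGE⇒≤part sorted n n<c))
  where d≤n = s≤s⁻¹ d<n+1
... | no n≮c  | inj₂ refl  = contradiction (≤part⇒<countGE sorted n (below n ≤-refl)) n≮c
... | no _    | inj₁ d<n+1 = largestSFrom-unique sorted below above n (s≤s⁻¹ d<n+1)

-- Wrapping a partition in a hook

-- wrap x μ surrounds μ (of length ≤ x) by a hook whose arm and leg both have length x.
wrapBelow : ℕ → List ℕ → List ℕ
wrapBelow x μ = map suc μ ++ replicate (x ∸ length μ) 1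

wrap : ℕ → List ℕ → List ℕ
wrap x μ = suc x ∷ wrapBelow x μ

length-wrapBelow : ∀ {x} μ → length μ ≤ x → length (wrapBelow x μ) ≡ x
length-wrapBelow {x} μ n≤x = begin
  length (map suc μ ++ replicate (x ∸ length μ) 1)          ≡⟨ length-++ (map suc μ) ⟩
  length (map suc μ) + length (replicate (x ∸ length μ) 1)  ≡⟨ cong₂ _+_ (length-map suc μ) (length-replicate _) ⟩
  length μ + (x ∸ length μ)                                 ≡⟨ m+[n∸m]≡n n≤x ⟩
  x                                                         ∎
  where open ≡-Reasoning

wrapBelow-positive : ∀ x μ → All (1 ≤_) (wrapBelow x μ)
wrapBelow-positive x μ = ++⁺ (map⁺ (All.universal (λ _ → s≤s z≤n) μ)) (replicate⁺ _ ≤-refl)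

wrap-sorted : ∀ {x μ} → Linked _≥_ (x ∷ μ) → Linked _≥_ (wrap x μ)
wrap-sorted = shifted-sorted _
  where
  ones-sorted : ∀ k → Linked _≥_ (1 ∷ replicate k 1)
  ones-sorted zero    = [-]
  ones-sorted (suc k) = ≤-refl ∷ ones-sorted k
  shifted-sorted : ∀ {x μ} k → Linked _≥_ (x ∷ μ) → Linked _≥_ (suc x ∷ map suc μ ++ replicate k 1)
  shifted-sorted {μ = []}    zero    _              = [-]
  shifted-sorted {μ = []}    (suc k) _              = s≤s z≤n ∷ ones-sorted k
  shifted-sorted {μ = _ ∷ _} k       (y≤x ∷ sorted) = s≤s y≤x ∷ shifted-sorted k sorted

part-wrapBelow-< : ∀ x μ {j} → j < length μ → part (wrapBelow x μ) j ≡ suc (part μ j)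
part-wrapBelow-< x μ {j} j<n =
  trans (part-++ˡ (map suc μ) _ (subst (j <_) (sym (length-map suc μ)) j<n)) (part-map-suc μ j<n)

part-wrapBelow-leg : ∀ x μ {j} → length μ ≤ j → j < x → part (wrapBelow x μ) j ≡ 1
part-wrapBelow-leg x μ {j} n≤j j<x = begin
  part (map suc μ ++ _) j                                      ≡⟨ cong (part (map suc μ ++ _)) j≡n+[j∸n] ⟩
  part (map suc μ ++ _) (length (map suc μ) + (j ∸ length μ))  ≡⟨ part-++ʳ (map suc μ) _ (j ∸ length μ) ⟩
  part (replicate (x ∸ length μ) 1) (j ∸ length μ)             ≡⟨ part-replicate _ 1 (∸-monoˡ-< j<x n≤j) ⟩
  1                                                            ∎
  where
  open ≡-Reasoning
  j≡n+[j∸n] : j ≡ length (map suc μ) + (j ∸ length μ)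
  j≡n+[j∸n] = trans (sym (m+[n∸m]≡n n≤j)) (cong (_+ (j ∸ length μ)) (sym (length-map suc μ)))

part-wrapBelow-≥ : ∀ {x} μ {j} → length μ ≤ x → x ≤ j → part (wrapBelow x μ) j ≡ 0
part-wrapBelow-≥ {x} μ n≤x x≤j = part-≥length (wrapBelow x μ) (subst (_≤ _) (sym (length-wrapBelow μ n≤x)) x≤j)

part-wrapBelow-≤ : ∀ {x} μ j → length μ ≤ x → part (wrapBelow x μ) j ≤ suc (part μ j)
part-wrapBelow-≤ {x} μ j n≤x with j <? length μ | j <? x
... | yes j<n | _       = ≤-reflexive (part-wrapBelow-< x μ j<n)
... | no  j≮n | yes j<x =
  ≤-reflexive (trans (part-wrapBelow-leg x μ (≮⇒≥ j≮n) j<x) (cong suc (sym (part-≥length μ (≮⇒≥ j≮n)))))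
... | no  _   | no  j≮x = subst (_≤ suc (part μ j)) (sym (part-wrapBelow-≥ μ n≤x (≮⇒≥ j≮x))) z≤n

countGE-wrapBelow : ∀ x μ j → countGE (wrapBelow x μ) (2 + j) ≡ countGE μ (suc j)
countGE-wrapBelow x μ j = begin
  countGE (map suc μ ++ ones) (2 + j)                   ≡⟨ countGE-++ (map suc μ) ones (2 + j) ⟩
  countGE (map suc μ) (2 + j) + countGE ones (2 + j)    ≡⟨ cong₂ _+_ (countGE-map-suc μ (suc j)) ones-too-small ⟩
  countGE μ (suc j) + 0                                 ≡⟨ +-identityʳ _ ⟩
  countGE μ (suc j)                                     ∎
  where
  open ≡-Reasoning
  ones = replicate (x ∸ length μ) 1
  ones-too-small : countGE ones (2 + j) ≡ 0
  ones-too-small = countGE-all< {2 + j} {ones} (replicate⁺ _ (s≤s (s≤s z≤n)))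

conjPart-wrap-< : ∀ {x} μ {j} → j < x → conjPart (wrap x μ) (suc j) ≡ suc (conjPart μ j)
conjPart-wrap-< {x} μ {j} j<x = trans (countGE-accept (wrapBelow x μ) (s≤s j<x)) (cong suc (countGE-wrapBelow x μ j))

conjPart-wrap-≥ : ∀ {x} μ {j} → x ≤ j → conjPart (wrap x μ) (suc j) ≡ conjPart μ j
conjPart-wrap-≥ {x} μ {j} x≤j =
  trans (countGE-reject (wrapBelow x μ) (<⇒≱ (s≤s (s≤s x≤j)))) (countGE-wrapBelow x μ j)

conjPart-wrap-zero : ∀ {x} μ → length μ ≤ x → conjPart (wrap x μ) 0 ≡ suc x
conjPart-wrap-zero {x} μ n≤x = cong suc (trans (countGE-all≥ (wrapBelow-positive x μ)) (length-wrapBelow μ n≤x))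

wrap-selfConjugate-at : ∀ {x} μ → length μ ≤ x → ∀ j →
                        conjPart (wrap x μ) (suc j) ≡ part (wrap x μ) (suc j) ⇔ conjPart μ j ≡ part μ j
wrap-selfConjugate-at {x} μ n≤x j with j <? x | j <? length μ
... | yes j<x | yes j<n
  rewrite conjPart-wrap-< μ j<x | part-wrapBelow-< x μ j<n = mk⇔ suc-injective (cong suc)
... | yes j<x | no j≮n
  rewrite conjPart-wrap-< μ j<x | part-wrapBelow-leg x μ (≮⇒≥ j≮n) j<x | part-≥length μ (≮⇒≥ j≮n)
  = mk⇔ suc-injective (cong suc)
... | no j≮x | _
  rewrite conjPart-wrap-≥ μ (≮⇒≥ j≮x) | part-wrapBelow-≥ μ n≤x (≮⇒≥ j≮x)
        | part-≥length μ (≤-trans n≤x (≮⇒≥ j≮x)) = mk⇔ id id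

wrap-selfConjugate : ∀ {x} μ → length μ ≤ x → IsSelfConjugate μ → IsSelfConjugate (wrap x μ)
wrap-selfConjugate μ n≤x sc zero    = conjPart-wrap-zero μ n≤x
wrap-selfConjugate μ n≤x sc (suc j) = Equivalence.from (wrap-selfConjugate-at μ n≤x j) (sc j)

wrap-selfConjugate⁻ : ∀ {x} μ → length μ ≤ x → IsSelfConjugate (wrap x μ) → IsSelfConjugate μ
wrap-selfConjugate⁻ μ n≤x sc j = Equivalence.to (wrap-selfConjugate-at μ n≤x j) (sc (suc j))

InDiagram-wrap⁻ : ∀ {x} μ {i j} → length μ ≤ x → InDiagram (wrap x μ) (suc i) (suc j) → InDiagram μ i j
InDiagram-wrap⁻ μ {i} n≤x j+1<p = s≤s⁻¹ (<-≤-trans j+1<p (part-wrapBelow-≤ μ i n≤x))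

module _ {x μ} (sorted : Linked _≥_ (x ∷ μ)) {i j} (j<μᵢ : InDiagram μ i j) where

  private
    i<n : i < length μ
    i<n = part>0⇒<length μ (≤-<-trans z≤n j<μᵢ)

    j<x : j < x
    j<x = <-≤-trans j<μᵢ (part-antitone sorted {0} {suc i} z≤n)

  InDiagram-wrap⁺ : InDiagram (wrap x μ) (suc i) (suc j)
  InDiagram-wrap⁺ = subst (suc j <_) (sym (part-wrapBelow-< x μ i<n)) (s≤s j<μᵢ)

  hook-wrap-inner : hook (wrap x μ) (suc i) (suc j) ≡ hook μ i j
  hook-wrap-inner = cong₂ (λ p c → (p ∸ suc (suc j)) + (c ∸ suc (suc i)) + 1)
                          (part-wrapBelow-< x μ i<n) (conjPart-wrap-< μ j<x)

-- Self-conjugate partitions from their arm lengths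

Strict : List ℕ → Set
Strict = AllPairs _>_

Gapped : List ℕ → Set
Gapped = AllPairs (λ x y → 2 + y ≤ x)

gapped⇒strict : ∀ {a} → Gapped a → Strict a
gapped⇒strict = AllPairs.map (≤-trans (n≤1+n _))

-- The self-conjugate partition with Frobenius coordinates (a | a): its i-th diagonal box has arm a_i.
fromArms : List ℕ → List ℕ
fromArms []      = []
fromArms (x ∷ a) = wrap x (fromArms a)

width : List ℕ → ℕ
width []      = 0
width (x ∷ _) = suc x

armHook : ℕ → ℕ
armHook x = suc (x + x)

hookSum : List ℕ → ℕ
hookSum a = sum (map armHook a)

width-≤ : ∀ {x a} → Strict (x ∷ a) → width a ≤ x
width-≤ {a = []}    _               = z≤n
width-≤ {a = y ∷ a} ((y<x ∷ _) ∷ _) = y<x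

width≤⇒all< : ∀ {x a} → Strict a → width a ≤ x → All (_< x) a
width≤⇒all< {a = []}    _           _   = []
width≤⇒all< {a = y ∷ a} (below ∷ _) y<x = y<x ∷ All.map (λ z<y → <-trans z<y y<x) below

length-fromArms : ∀ {a} → Strict a → length (fromArms a) ≡ width a

length-fromArms-≤ : ∀ {x a} → Strict (x ∷ a) → length (fromArms a) ≤ x
length-fromArms-≤ {x} s = subst (_≤ x) (sym (length-fromArms (AllPairs.tail s))) (width-≤ s)

length-fromArms {[]}    _ = refl
length-fromArms {x ∷ a} s = cong suc (length-wrapBelow (fromArms a) (length-fromArms-≤ s))

fromArms-positive : ∀ a → All (1 ≤_) (fromArms a)
fromArms-positive []      = []
fromArms-positive (x ∷ a) = s≤s z≤n ∷ wrapBelow-positive x (fromArms a)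

fromArms-sorted : ∀ {a} → Strict a → Linked _≥_ (fromArms a)

fromArms-sorted-under : ∀ {x a} → Strict (x ∷ a) → Linked _≥_ (x ∷ fromArms a)
fromArms-sorted-under {a = []}    _                 = [-]
fromArms-sorted-under {a = y ∷ a} s@((y<x ∷ _) ∷ _) = y<x ∷ fromArms-sorted (AllPairs.tail s)

fromArms-sorted {[]}    _ = []
fromArms-sorted {x ∷ a} s = wrap-sorted (fromArms-sorted-under s)

fromArms-selfConjugate : ∀ {a} → Strict a → IsSelfConjugate (fromArms a)
fromArms-selfConjugate {[]}    _ _ = refl
fromArms-selfConjugate {x ∷ a} s   =
  wrap-selfConjugate (fromArms a) (length-fromArms-≤ s) (fromArms-selfConjugate (AllPairs.tail s))

fromArms-isPartition : ∀ {a} → Strict a → IsPartition (fromArms a)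
fromArms-isPartition {a} s = fromArms-sorted s , fromArms-positive a

size-wrap : ∀ {x} μ → length μ ≤ x → size (wrap x μ) ≡ armHook x + size μ
size-wrap {x} μ n≤x = begin
  suc x + sum (map suc μ ++ ones)                   ≡⟨ cong (suc x +_) (sum-++ (map suc μ) ones) ⟩
  suc x + (sum (map suc μ) + sum ones)              ≡⟨ cong (suc x +_) (cong₂ _+_ (sum-map-suc μ) (sum-ones _)) ⟩
  suc x + ((size μ + length μ) + (x ∸ length μ))    ≡⟨ cong (suc x +_) (+-assoc (size μ) _ _) ⟩
  suc x + (size μ + (length μ + (x ∸ length μ)))    ≡⟨ cong (λ k → suc x + (size μ + k)) (m+[n∸m]≡n n≤x) ⟩
  suc x + (size μ + x)                              ≡⟨ regroup x (size μ) ⟩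
  armHook x + size μ                                ∎
  where
  open ≡-Reasoning
  ones = replicate (x ∸ length μ) 1
  regroup : ∀ x s → suc x + (s + x) ≡ suc (x + x) + s
  regroup = solve-∀
  shift-suc : ∀ x s n → suc x + (s + n) ≡ x + s + suc n
  shift-suc = solve-∀
  sum-map-suc : ∀ xs → sum (map suc xs) ≡ sum xs + length xs
  sum-map-suc []       = refl
  sum-map-suc (x ∷ xs) = trans (cong (suc x +_) (sum-map-suc xs)) (shift-suc x (sum xs) (length xs))
  sum-ones : ∀ k → sum (replicate k 1) ≡ k
  sum-ones zero    = refl
  sum-ones (suc k) = cong suc (sum-ones k)

size-fromArms : ∀ {a} → Strict a → size (fromArms a) ≡ hookSum a
size-fromArms {[]}    _ = refl
size-fromArms {x ∷ a} s =
  trans (size-wrap (fromArms a) (length-fromArms-≤ s)) (cong (armHook x +_) (size-fromArms (AllPairs.tail s)))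

length≤width : ∀ {a} → Strict a → length a ≤ width a
length≤width {[]}    _ = z≤n
length≤width {x ∷ a} s = s≤s (≤-trans (length≤width (AllPairs.tail s)) (width-≤ s))

part-fromArms : ∀ {a} → Strict a → ∀ {i} → i < length a → part (fromArms a) i ≡ suc (part a i + i)
part-fromArms {x ∷ a} s {zero}  _   = cong suc (sym (+-identityʳ x))
part-fromArms {x ∷ a} s {suc i} i<n = begin
  part (wrapBelow x (fromArms a)) i  ≡⟨ part-wrapBelow-< x (fromArms a) i<width ⟩
  suc (part (fromArms a) i)          ≡⟨ cong suc (part-fromArms (AllPairs.tail s) (s≤s⁻¹ i<n)) ⟩
  suc (suc (part a i + i))           ≡⟨ cong suc (+-suc (part a i) i) ⟨
  suc (part a i + suc i)             ∎
  where
  open ≡-Reasoning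
  i<width : i < length (fromArms a)
  i<width = subst (i <_) (sym (length-fromArms (AllPairs.tail s)))
                  (<-≤-trans (s≤s⁻¹ i<n) (length≤width (AllPairs.tail s)))

part-fromArms-length : ∀ {a} → Strict a → part (fromArms a) (length a) ≤ length a
part-fromArms-length {[]}    _ = z≤n
part-fromArms-length {x ∷ a} s = ≤-trans (part-wrapBelow-≤ (fromArms a) (length a) (length-fromArms-≤ s))
                                         (s≤s (part-fromArms-length (AllPairs.tail s)))

durfee-fromArms : ∀ {a} → Strict a → durfee (fromArms a) ≡ length a
durfee-fromArms {a} s = largestSFrom-unique (fromArms-sorted s) below-diagonal (part-fromArms-length s)
  (length (fromArms a)) (subst (length a ≤_) (sym (length-fromArms s)) (length≤width s))
  where
  below-diagonal : ∀ m → m < length a → suc m ≤ part (fromArms a) m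
  below-diagonal m m<n = subst (suc m ≤_) (sym (part-fromArms s m<n)) (s≤s (m≤n+m m _))

hook-fromArms-diagonal : ∀ {a} → Strict a → ∀ {i} → i < length a → hook (fromArms a) i i ≡ armHook (part a i)
hook-fromArms-diagonal {a} s {i} i<n = begin
  hook (fromArms a) i i                        ≡⟨ hook-selfConjugate (fromArms a) (fromArms-selfConjugate s) i i ⟩
  (p ∸ suc i) + (p ∸ suc i) + 1                ≡⟨ cong (λ q → (q ∸ suc i) + (q ∸ suc i) + 1) (part-fromArms s i<n) ⟩
  (part a i + i ∸ i) + (part a i + i ∸ i) + 1  ≡⟨ cong (λ q → q + q + 1) (m+n∸n≡m (part a i) i) ⟩
  part a i + part a i + 1                      ≡⟨ +-comm _ 1 ⟩
  armHook (part a i)                           ∎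
  where
  open ≡-Reasoning
  p = part (fromArms a) i

armHook-injective : ∀ {x y} → armHook x ≡ armHook y → x ≡ y
armHook-injective {zero}  {zero}  _ = refl
armHook-injective {suc x} {suc y} e = cong suc (armHook-injective (suc-injective (begin
  suc (suc (x + x))  ≡⟨ cong suc (+-suc x x) ⟨
  suc (x + suc x)    ≡⟨ suc-injective e ⟩
  suc (y + suc y)    ≡⟨ cong suc (+-suc y y) ⟩
  suc (suc (y + y))  ∎)))
  where open ≡-Reasoning

part∈ : ∀ a {i} → i < length a → part a i ∈ a
part∈ (x ∷ a) {zero}  _   = here refl
part∈ (x ∷ a) {suc i} i<n = there (part∈ a (s≤s⁻¹ i<n))

∈⇒∃part : ∀ {a y} → y ∈ a → ∃[ i ] (i < length a × part a i ≡ y)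
∈⇒∃part (here refl) = zero , z<s , refl
∈⇒∃part (there y∈a) with i , i<n , eq ← ∈⇒∃part y∈a = suc i , s≤s i<n , eq

InMD-fromArms⁺ : ∀ {a y} → Strict a → y ∈ a → InMD (fromArms a) (armHook y)
InMD-fromArms⁺ s y∈a with i , i<n , refl ← ∈⇒∃part y∈a =
  i , subst (i <_) (sym (durfee-fromArms s)) i<n , hook-fromArms-diagonal s i<n

InMD-fromArms⁻ : ∀ {a y} → Strict a → InMD (fromArms a) (armHook y) → y ∈ a
InMD-fromArms⁻ {a} s (i , i<d , hookᵢᵢ≡) =
  subst (_∈ a) (armHook-injective (trans (sym (hook-fromArms-diagonal s i<n)) hookᵢᵢ≡)) (part∈ a i<n)
  where
  i<n : i < length a
  i<n = subst (i <_) (durfee-fromArms s) i<d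

removeFirstColumn : ∀ {μ} → IsPartition μ → ∃[ ν ] ∃[ k ] (μ ≡ map suc ν ++ replicate k 1 × IsPartition ν)
removeFirstColumn {[]}              _                  = [] , 0 , refl , [] , []
removeFirstColumn {suc zero ∷ μ}    (sorted , _ ∷ pos) =
  [] , suc (length μ) , cong (1 ∷_) (all-ones (sorted-bounded sorted) pos) , [] , []
  where
  all-ones : ∀ {xs} → All (_≤ 1) xs → All (1 ≤_) xs → xs ≡ replicate (length xs) 1
  all-ones []       []       = refl
  all-ones (p ∷ ps) (q ∷ qs) = cong₂ _∷_ (≤-antisym p q) (all-ones ps qs)
removeFirstColumn {suc (suc x) ∷ μ} (sorted , _ ∷ pos) with removeFirstColumn (Linked.tail sorted , pos)
... | ν , k , refl , (ν-sorted , ν-pos) = suc x ∷ ν , k , refl , head-sorted ν sorted ν-sorted , s≤s z≤n ∷ ν-pos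
  where
  head-sorted : ∀ ν → Linked _≥_ (suc (suc x) ∷ map suc ν ++ replicate k 1) → Linked _≥_ ν →
                Linked _≥_ (suc x ∷ ν)
  head-sorted []      _         _        = [-]
  head-sorted (_ ∷ _) (v≤x ∷ _) ν-sorted = s≤s⁻¹ v≤x ∷ ν-sorted

wrap-decomposition : ∀ {x μ} → IsPartition (suc x ∷ μ) → IsSelfConjugate (suc x ∷ μ) →
                     ∃[ ν ] (IsPartition ν × length ν ≤ x × μ ≡ wrapBelow x ν)
wrap-decomposition {x} (sorted , pos) sc with removeFirstColumn (Linked.tail sorted , All.tail pos)
... | ν , k , refl , ν-partition =
  ν , ν-partition , subst (length ν ≤_) ν+k≡x (m≤m+n (length ν) k) ,
  cong (λ n → map suc ν ++ replicate n 1) (sym (trans (cong (_∸ length ν) (sym ν+k≡x)) (m+n∸m≡n (length ν) k)))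
  where
  ν+k≡x : length ν + k ≡ x
  ν+k≡x = begin
    length ν + k                                  ≡⟨ cong₂ _+_ (length-map suc ν) (length-replicate k) ⟨
    length (map suc ν) + length (replicate k 1)   ≡⟨ length-++ (map suc ν) ⟨
    length (map suc ν ++ replicate k 1)           ≡⟨ suc-injective (countGE-all≥ pos) ⟨
    countGE (map suc ν ++ replicate k 1) 1        ≡⟨ suc-injective (sc 0) ⟩
    x                                             ∎
    where open ≡-Reasoning

selfConjugate⇒fromArms : ∀ {μ} → IsPartition μ → IsSelfConjugate μ → ∃[ a ] (Strict a × μ ≡ fromArms a)
selfConjugate⇒fromArms {μ} = peel (length μ) ≤-refl
  where
  peel : ∀ n {μ} → length μ ≤ n → IsPartition μ → IsSelfConjugate μ → ∃[ a ] (Strict a × μ ≡ fromArms a)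
  peel _       {[]}        _   _              _  = [] , [] , refl
  peel _       {zero ∷ _}  _   (_ , () ∷ _)   _
  peel (suc n) {suc x ∷ _} len μ-partition sc
    with ν , ν-partition , ν≤x , refl ← wrap-decomposition μ-partition sc
    with a , s , refl ← peel n (≤-trans ν≤x (subst (_≤ n) (length-wrapBelow ν ν≤x) (s≤s⁻¹ len)))
                             ν-partition (wrap-selfConjugate⁻ ν ν≤x sc)
    = x ∷ a , width≤⇒all< s (subst (_≤ x) (length-fromArms s) ν≤x) ∷ s , refl

-- First-row hooks

m∸n+[n∸o]≡m∸o : ∀ {m n o} → o ≤ n → n ≤ m → (m ∸ n) + (n ∸ o) ≡ m ∸ o
m∸n+[n∸o]≡m∸o {m} {n} {o} o≤n n≤m = begin
  (m ∸ n) + (n ∸ o)  ≡⟨ +-∸-assoc (m ∸ n) o≤n ⟨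
  (m ∸ n) + n ∸ o    ≡⟨ cong (_∸ o) (m∸n+n≡m n≤m) ⟩
  m ∸ o              ∎
  where open ≡-Reasoning

m∸n+[1+n+o]≡1+m+o : ∀ {m n} o → n ≤ m → (m ∸ n) + suc (n + o) ≡ suc (m + o)
m∸n+[1+n+o]≡1+m+o {m} {n} o n≤m = begin
  (m ∸ n) + suc (n + o)  ≡⟨ +-suc (m ∸ n) (n + o) ⟩
  suc ((m ∸ n) + (n + o))  ≡⟨ cong suc (+-assoc (m ∸ n) n o) ⟨
  suc ((m ∸ n) + n + o)  ≡⟨ cong (λ k → suc (k + o)) (m∸n+n≡m n≤m) ⟩
  suc (m + o)            ∎
  where open ≡-Reasoning

hook-wrap-corner : ∀ {x} μ → length μ ≤ x → hook (wrap x μ) 0 0 ≡ armHook x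
hook-wrap-corner {x} μ n≤x = trans (cong (λ c → x + (c ∸ 1) + 1) (conjPart-wrap-zero μ n≤x)) (+-comm (x + x) 1)

hook-wrap-first-row : ∀ {x} μ {j} → j < x → hook (wrap x μ) 0 (suc j) ≡ (x ∸ suc j) + conjPart μ j + 1
hook-wrap-first-row {x} μ {j} j<x = cong (λ c → (x ∸ suc j) + (c ∸ 1) + 1) (conjPart-wrap-< μ j<x)

hook-wrap-leg : ∀ {x} μ {j} → IsSelfConjugate μ → length μ ≤ j → j < x → hook (wrap x μ) 0 (suc j) ≡ x ∸ j
hook-wrap-leg {x} μ {j} sc n≤j j<x = begin
  hook (wrap x μ) 0 (suc j)         ≡⟨ hook-wrap-first-row μ j<x ⟩
  (x ∸ suc j) + conjPart μ j + 1    ≡⟨ cong (λ c → (x ∸ suc j) + c + 1) (trans (sc j) (part-≥length μ n≤j)) ⟩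
  (x ∸ suc j) + 0 + 1               ≡⟨ trans (cong (_+ 1) (+-identityʳ _)) (+-comm _ 1) ⟩
  suc (x ∸ suc j)                   ≡⟨ +-∸-assoc 1 j<x ⟨
  x ∸ j                             ∎
  where open ≡-Reasoning

hook-wrap-wrap : ∀ {x y} ν {j} → j ≤ y → y < x →
                 hook (wrap x (wrap y ν)) 0 (suc j) ≡ (x ∸ y) + hook (wrap y ν) 0 j
hook-wrap-wrap {x} {y} ν {j} j≤y y<x = begin
  hook (wrap x μ) 0 (suc j)          ≡⟨ hook-wrap-first-row μ (≤-<-trans j≤y y<x) ⟩
  (x ∸ suc j) + conjPart μ j + 1     ≡⟨ cong (λ c → (x ∸ suc j) + c + 1) conjPart≡ ⟩
  (x ∸ suc j) + suc c + 1            ≡⟨ cong (_+ 1) (+-suc (x ∸ suc j) c) ⟩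
  suc (x ∸ suc j) + c + 1            ≡⟨ cong (λ d → d + c + 1) (+-∸-assoc 1 (≤-<-trans j≤y y<x)) ⟨
  (x ∸ j) + c + 1                    ≡⟨ cong (λ d → d + c + 1) (m∸n+[n∸o]≡m∸o j≤y (<⇒≤ y<x)) ⟨
  (x ∸ y) + (y ∸ j) + c + 1          ≡⟨ reassociate (x ∸ y) (y ∸ j) c ⟩
  (x ∸ y) + ((y ∸ j) + c + 1)        ≡⟨ cong (λ c′ → (x ∸ y) + ((y ∸ j) + (c′ ∸ 1) + 1)) conjPart≡ ⟨
  (x ∸ y) + hook μ 0 j               ∎
  where
  open ≡-Reasoning
  μ = wrap y ν
  c = countGE (wrapBelow y ν) (suc j)
  conjPart≡ : conjPart μ j ≡ suc c
  conjPart≡ = countGE-accept (wrapBelow y ν) (s≤s j≤y)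
  reassociate : ∀ a b c → a + b + c + 1 ≡ a + (b + c + 1)
  reassociate = solve-∀

FirstRowHook : List ℕ → ℕ → Set
FirstRowHook μ v = ∃[ j ] (InDiagram μ 0 j × hook μ 0 j ≡ v)

firstRowHook-wrap : ∀ {x y} ν {v} → y < x → FirstRowHook (wrap y ν) v →
                    FirstRowHook (wrap x (wrap y ν)) ((x ∸ y) + v)
firstRowHook-wrap ν y<x (j , j<y+1 , refl) = suc j , s≤s (<-≤-trans j<y+1 y<x) , hook-wrap-wrap ν (s≤s⁻¹ j<y+1) y<x

firstRowHook-leg : ∀ {x} μ {j} → IsSelfConjugate μ → length μ ≤ j → j < x → FirstRowHook (wrap x μ) (x ∸ j)
firstRowHook-leg μ sc n≤j j<x = suc _ , s≤s j<x , hook-wrap-leg μ sc n≤j j<x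

firstRowHook-corner : ∀ {x a} → Strict (x ∷ a) → FirstRowHook (fromArms (x ∷ a)) (armHook x)
firstRowHook-corner {a = a} s = 0 , z<s , hook-wrap-corner (fromArms a) (length-fromArms-≤ s)

firstRowHook-armPairs : ∀ {x a} → Strict (x ∷ a) →
                        All (λ y → FirstRowHook (fromArms (x ∷ a)) (suc (x + y))) (x ∷ a)
firstRowHook-armPairs {a = []}        s = firstRowHook-corner s ∷ []
firstRowHook-armPairs {x} {a = y ∷ r} s@((y<x ∷ _) ∷ _) =
  firstRowHook-corner s ∷ All.map shift (firstRowHook-armPairs (AllPairs.tail s))
  where
  shift : ∀ {z} → FirstRowHook (fromArms (y ∷ r)) (suc (y + z)) → FirstRowHook (fromArms (x ∷ y ∷ r)) (suc (x + z))
  shift {z} = subst (FirstRowHook (fromArms (x ∷ y ∷ r))) (m∸n+[1+n+o]≡1+m+o z (<⇒≤ y<x))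
            ∘ firstRowHook-wrap (fromArms r) y<x

firstRowHook-cases : ∀ {x a v} → Strict (x ∷ a) → FirstRowHook (fromArms (x ∷ a)) v →
                     v ≤ x ⊎ Any (λ y → v ≡ suc (x + y)) (x ∷ a)
firstRowHook-cases {a = a} s (zero , _ , refl) = inj₂ (here (hook-wrap-corner (fromArms a) (length-fromArms-≤ s)))
firstRowHook-cases {x} {a} s (suc j , j<x+1 , refl) with j <? length (fromArms a)
... | no j≮n = inj₁ (subst (_≤ x) (sym leg≡) (m∸n≤m x j))
  where
  leg≡ = hook-wrap-leg (fromArms a) (fromArms-selfConjugate (AllPairs.tail s)) (≮⇒≥ j≮n) (s≤s⁻¹ j<x+1)
firstRowHook-cases {x} {y ∷ r} s@((y<x ∷ _) ∷ _) (suc j , _ , refl) | yes j<n =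
  subst (λ h → h ≤ x ⊎ Any (λ z → h ≡ suc (x + z)) (x ∷ y ∷ r)) (sym hook≡)
    (Sum.map shift-≤ (there ∘ Any.map shift-≡) (firstRowHook-cases (AllPairs.tail s) (j , j<y+1 , refl)))
  where
  j<y+1 : j < suc y
  j<y+1 = subst (j <_) (length-fromArms (AllPairs.tail s)) j<n
  hook≡ = hook-wrap-wrap (fromArms r) (s≤s⁻¹ j<y+1) y<x
  shift-≤ : ∀ {w} → w ≤ y → (x ∸ y) + w ≤ x
  shift-≤ w≤y = ≤-trans (+-monoʳ-≤ (x ∸ y) w≤y) (≤-reflexive (m∸n+n≡m (<⇒≤ y<x)))
  shift-≡ : ∀ {w z} → w ≡ suc (y + z) → (x ∸ y) + w ≡ suc (x + z)
  shift-≡ {z = z} refl = m∸n+[1+n+o]≡1+m+o z (<⇒≤ y<x)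

firstRowHook-leg-reach : ∀ {x a v} → Strict (x ∷ a) → length (fromArms a) ≤ x ∸ v → 1 ≤ v → v ≤ x →
                         FirstRowHook (fromArms (x ∷ a)) v
firstRowHook-leg-reach {x} {a} s n≤x∸v 1≤v v≤x = subst (FirstRowHook (fromArms (x ∷ a))) (m∸[m∸n]≡n v≤x)
  (firstRowHook-leg (fromArms a) (fromArms-selfConjugate (AllPairs.tail s)) n≤x∸v (∸-monoʳ-< 1≤v v≤x))

firstRowHook-one : ∀ {y r} → Gapped (y ∷ r) → FirstRowHook (fromArms (y ∷ r)) 1
firstRowHook-one {zero}      g = firstRowHook-corner (gapped⇒strict g)
firstRowHook-one {suc y} {r} g = firstRowHook-leg-reach (gapped⇒strict g) n≤y (s≤s z≤n) (s≤s z≤n)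
  where
  width≤y : ∀ {r} → Gapped (suc y ∷ r) → width r ≤ y
  width≤y {[]}    _                   = z≤n
  width≤y {_ ∷ _} ((2+z≤1+y ∷ _) ∷ _) = s≤s⁻¹ 2+z≤1+y
  n≤y : length (fromArms r) ≤ suc y ∸ 1
  n≤y = subst (_≤ y) (sym (length-fromArms (gapped⇒strict (AllPairs.tail g)))) (width≤y g)

firstRowHook-cover : ∀ {x a v} → Gapped (x ∷ a) → 1 ≤ v → v ≤ x →
                     FirstRowHook (fromArms (x ∷ a)) v ⊎ FirstRowHook (fromArms (x ∷ a)) (suc v)
firstRowHook-cover {x} {[]} g 1≤v v≤x = inj₁ (firstRowHook-leg-reach (gapped⇒strict g) z≤n 1≤v v≤x)
firstRowHook-cover {x} {y ∷ r} {v} g@((2+y≤x ∷ _) ∷ _) 1≤v v≤x with <-cmp (v + y) x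
... | tri< v+y<x _ _ = inj₁ (firstRowHook-leg-reach (gapped⇒strict g) n≤x∸v 1≤v v≤x)
  where
  n≤x∸v : length (fromArms (y ∷ r)) ≤ x ∸ v
  n≤x∸v = subst (_≤ x ∸ v) (sym (length-fromArms (gapped⇒strict (AllPairs.tail g))))
                (m+n≤o⇒m≤o∸n (suc y) (subst (_≤ x) (cong suc (+-comm v y)) v+y<x))
... | tri≈ _ v+y≡x _ =
  inj₂ (subst F x∸y+1≡v+1 (firstRowHook-wrap (fromArms r) y<x (firstRowHook-one (AllPairs.tail g))))
  where
  F = FirstRowHook (fromArms (x ∷ y ∷ r))
  y<x = <-trans (n<1+n y) 2+y≤x
  x∸y+1≡v+1 : (x ∸ y) + 1 ≡ suc v
  x∸y+1≡v+1 = trans (cong (λ k → (k ∸ y) + 1) (sym v+y≡x)) (trans (cong (_+ 1) (m+n∸n≡m v y)) (+-comm v 1))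
... | tri> _ _ x<v+y =
  Sum.map (subst F x∸y+v′≡v ∘ lift) (subst F x∸y+[v′+1]≡v+1 ∘ lift)
          (firstRowHook-cover (AllPairs.tail g) (m<n⇒0<n∸m x∸y<v) v′≤y)
  where
  F = FirstRowHook (fromArms (x ∷ y ∷ r))
  y<x = <-trans (n<1+n y) 2+y≤x
  lift : ∀ {w} → FirstRowHook (fromArms (y ∷ r)) w → F ((x ∸ y) + w)
  lift = firstRowHook-wrap (fromArms r) y<x
  v′ = v ∸ (x ∸ y)
  x∸y<v : x ∸ y < v
  x∸y<v = subst (x ∸ y <_) (m+n∸n≡m v y) (∸-monoˡ-< x<v+y (<⇒≤ y<x))
  x∸y+v′≡v : (x ∸ y) + v′ ≡ v
  x∸y+v′≡v = m+[n∸m]≡n (<⇒≤ x∸y<v)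
  x∸y+[v′+1]≡v+1 : (x ∸ y) + suc v′ ≡ suc v
  x∸y+[v′+1]≡v+1 = trans (+-suc (x ∸ y) v′) (cong suc x∸y+v′≡v)
  v′≤y : v′ ≤ y
  v′≤y = ≤-trans (∸-monoˡ-≤ (x ∸ y) v≤x) (≤-reflexive (m∸[m∸n]≡n (<⇒≤ y<x)))

-- (t, t+1)-cores

isCore-wrap-inner : ∀ {t x μ} → Linked _≥_ (x ∷ μ) → IsCore t (wrap x μ) → IsCore t μ
isCore-wrap-inner {t} sorted core i j j<μᵢ =
  subst (λ h → ¬ t ∣ h) (hook-wrap-inner sorted j<μᵢ) (core (suc i) (suc j) (InDiagram-wrap⁺ sorted j<μᵢ))

CoreHook : ℕ → ℕ → Set
CoreHook t h = ¬ t ∣ h × ¬ suc t ∣ h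

Avoids : ℕ → ℕ → Set
Avoids t h = h ≢ t × h ≢ suc t

CoreArms : ℕ → List ℕ → Set
CoreArms t []      = ⊤
CoreArms t (x ∷ a) = x < t × All (λ y → Avoids t (suc (x + y))) (x ∷ a) × CoreArms t a

∤-below-double : ∀ {d h} → 0 < h → h < d + d → h ≢ d → ¬ d ∣ h
∤-below-double 0<h h<2d h≢d (divides zero          refl) = <⇒≢ 0<h refl
∤-below-double 0<h h<2d h≢d (divides (suc zero)    refl) = h≢d (+-identityʳ _)
∤-below-double {d} 0<h h<2d h≢d (divides (suc (suc k)) refl) = <⇒≱ h<2d (+-monoʳ-≤ d (m≤m+n d (k * d)))

avoids⇒coreHook : ∀ {t h} → 0 < h → h < t + t → Avoids t h → CoreHook t h
avoids⇒coreHook {t} 0<h h<2t (h≢t , h≢t+1) =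
  ∤-below-double 0<h h<2t h≢t , ∤-below-double 0<h (<-≤-trans h<2t (+-mono-≤ (n≤1+n t) (n≤1+n t))) h≢t+1

small⇒avoids : ∀ {t h} → h < t → Avoids t h
small⇒avoids {t} h<t = <⇒≢ h<t , <⇒≢ (<-trans h<t (n<1+n t))

firstRowHook-core : ∀ {t x a v} → CoreArms t (x ∷ a) → Strict (x ∷ a) → FirstRowHook (fromArms (x ∷ a)) v →
                    CoreHook t v
firstRowHook-core {t} {x} {a} (x<t , avoids , _) s h@(j , _ , refl) with firstRowHook-cases s h
... | inj₁ v≤x =
  avoids⇒coreHook (hook-positive (fromArms (x ∷ a)) 0 j) (<-≤-trans v<t (m≤m+n t t)) (small⇒avoids v<t)
  where v<t = ≤-<-trans v≤x x<t
... | inj₂ v∈pairs = All.lookupWith core (All.zip (avoids , ≤-refl ∷ All.map <⇒≤ (AllPairs.head s))) v∈pairs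
  where
  core : ∀ {y v} → Avoids t (suc (x + y)) × y ≤ x → v ≡ suc (x + y) → CoreHook t v
  core {y} (avoid , y≤x) refl = avoids⇒coreHook z<s (+-mono-≤-< x<t (≤-<-trans y≤x x<t)) avoid

fromArms-coreHooks : ∀ {t a} → CoreArms t a → Strict a → ∀ i j → InDiagram (fromArms a) i j →
                     CoreHook t (hook (fromArms a) i j)
fromArms-coreHooks {a = x ∷ a} c s zero    j       d = firstRowHook-core c s (j , d , refl)
fromArms-coreHooks {t} {x ∷ a} c s (suc i) zero    d =
  subst (CoreHook t) (hook-sym (fromArms (x ∷ a)) (fromArms-selfConjugate s) 0 (suc i))
    (firstRowHook-core c s (suc i , InDiagram-sym (fromArms-isPartition s) (fromArms-selfConjugate s) d , refl))
fromArms-coreHooks {t} {x ∷ a} (_ , _ , c) s (suc i) (suc j) d =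
  subst (CoreHook t) (sym (hook-wrap-inner (fromArms-sorted-under s) inner))
    (fromArms-coreHooks c (AllPairs.tail s) i j inner)
  where
  inner = InDiagram-wrap⁻ (fromArms a) (length-fromArms-≤ s) d

cores⇒coreArms : ∀ {t a} → 0 < t → Gapped a → IsCore t (fromArms a) → IsCore (suc t) (fromArms a) → CoreArms t a
cores⇒coreArms {a = []}        _   _ _    _     = tt
cores⇒coreArms {t} {x ∷ a} 0<t g core core′ =
  x<t , All.map avoids (firstRowHook-armPairs s) ,
  cores⇒coreArms 0<t (AllPairs.tail g) (isCore-wrap-inner (fromArms-sorted-under s) core)
                                         (isCore-wrap-inner (fromArms-sorted-under s) core′)
  where
  s = gapped⇒strict g
  not-t : ∀ {v} → FirstRowHook (fromArms (x ∷ a)) v → v ≢ t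
  not-t (j , d , hook≡v) v≡t = core 0 j d (subst (t ∣_) (sym (trans hook≡v v≡t)) ∣-refl)
  not-t+1 : ∀ {v} → FirstRowHook (fromArms (x ∷ a)) v → v ≢ suc t
  not-t+1 (j , d , hook≡v) v≡t+1 = core′ 0 j d (subst (suc t ∣_) (sym (trans hook≡v v≡t+1)) ∣-refl)
  avoids : ∀ {v} → FirstRowHook (fromArms (x ∷ a)) v → Avoids t v
  avoids h = not-t h , not-t+1 h
  x<t : x < t
  x<t = ≰⇒> (λ t≤x → Sum.[ (λ h → not-t h refl) , (λ h → not-t+1 h refl) ] (firstRowHook-cover g 0<t t≤x))

gapped-part+index : ∀ {a} → Gapped a → ∀ {i k} → i < k → k < length a → part a k + k < part a i + i
gapped-part+index {x ∷ r} g {zero} {suc k} _ k<n =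
  subst (part r k + suc k <_) (sym (+-identityʳ x)) (below-head g (s≤s⁻¹ k<n))
  where
  below-head : ∀ {x r} → Gapped (x ∷ r) → ∀ {k} → k < length r → part r k + suc k < x
  below-head {x} {y ∷ r} ((2+y≤x ∷ _) ∷ _) {zero} _ = subst (_< x) (+-comm 1 y) 2+y≤x
  below-head {x} {y ∷ r} ((2+y≤x ∷ _) ∷ g) {suc k} k<n =
    subst (_< x) (sym (+-suc (part r k) (suc k)))
          (≤-<-trans (below-head g (s≤s⁻¹ k<n)) (<-trans (n<1+n y) 2+y≤x))
gapped-part+index {x ∷ r} g {suc i} {suc k} i<k k<n =
  subst₂ _<_ (sym (+-suc (part r k) k)) (sym (+-suc (part r i) i))
    (s≤s (gapped-part+index (AllPairs.tail g) (s≤s⁻¹ i<k) (s≤s⁻¹ k<n)))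

gapped⇒distinct : ∀ {a} → Gapped a → FirstPartsDistinct (fromArms a)
gapped⇒distinct {a} g i k i<k k<d μᵢ≡μₖ =
  <⇒≢ (gapped-part+index g i<k k<n) (sym (suc-injective (begin
    suc (part a i + i)    ≡⟨ part-fromArms s (<-trans i<k k<n) ⟨
    part (fromArms a) i   ≡⟨ μᵢ≡μₖ ⟩
    part (fromArms a) k   ≡⟨ part-fromArms s k<n ⟩
    suc (part a k + k)    ∎)))
  where
  open ≡-Reasoning
  s = gapped⇒strict g
  k<n : k < length a
  k<n = subst (k <_) (durfee-fromArms s) k<d

distinct⇒adjacent-gaps : ∀ {a} → Strict a → FirstPartsDistinct (fromArms a) →
                         ∀ i → suc i < length a → suc (part a (suc i)) ≢ part a i
distinct⇒adjacent-gaps {a} s distinct i i+1<n aᵢ₊₁+1≡aᵢ =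
  distinct i (suc i) (n<1+n i) (subst (suc i <_) (sym (durfee-fromArms s)) i+1<n) (begin
    part (fromArms a) i              ≡⟨ part-fromArms s (<-trans (n<1+n i) i+1<n) ⟩
    suc (part a i + i)               ≡⟨ cong (λ p → suc (p + i)) aᵢ₊₁+1≡aᵢ ⟨
    suc (suc (part a (suc i)) + i)   ≡⟨ cong suc (+-suc (part a (suc i)) i) ⟨
    suc (part a (suc i) + suc i)     ≡⟨ part-fromArms s i+1<n ⟨
    part (fromArms a) (suc i)        ∎)
  where open ≡-Reasoning

adjacent-gaps⇒gapped : ∀ {a} → Strict a → (∀ i → suc i < length a → suc (part a (suc i)) ≢ part a i) → Gapped a
adjacent-gaps⇒gapped {[]}        _ _ = []
adjacent-gaps⇒gapped {x ∷ []}    _ _ = [] ∷ []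
adjacent-gaps⇒gapped {x ∷ y ∷ r} ((y<x ∷ _) ∷ s) gaps =
  (2+y≤x ∷ All.map (λ z<y → ≤-trans (s≤s z<y) y<x) (AllPairs.head s)) ∷
  adjacent-gaps⇒gapped s (λ i → gaps (suc i) ∘ s≤s)
  where
  2+y≤x : 2 + y ≤ x
  2+y≤x with m≤n⇒m<n∨m≡n y<x
  ... | inj₁ y+1<x  = y+1<x
  ... | inj₂ y+1≡x = contradiction y+1≡x (gaps 0 (s≤s (s≤s z≤n)))

InDS⇒fromArms : ∀ {t μ} → 0 < t → InDS t μ → ∃[ a ] (Gapped a × CoreArms t a × μ ≡ fromArms a)
InDS⇒fromArms 0<t (partition , sc , core , core′ , distinct)
  with a , s , refl ← selfConjugate⇒fromArms partition sc =
  let g = adjacent-gaps⇒gapped s (distinct⇒adjacent-gaps s distinct)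
  in a , g , cores⇒coreArms 0<t g core core′ , refl

fromArms-InDS : ∀ {t a} → Gapped a → CoreArms t a → InDS t (fromArms a)
fromArms-InDS g c = fromArms-isPartition s , fromArms-selfConjugate s ,
  (λ i j d → proj₁ (fromArms-coreHooks c s i j d)) , (λ i j d → proj₂ (fromArms-coreHooks c s i j d)) ,
  gapped⇒distinct g
  where s = gapped⇒strict g

-- Maximal elements of DS(t)

avoids-large : ∀ {T z} → 2 ≤ z → Avoids (suc T) (suc (T + z))
avoids-large {T} {z} 2≤z = ≢-sym (<⇒≢ (<-trans (n<1+n (suc T)) T+2<T+z+1)) , ≢-sym (<⇒≢ T+2<T+z+1)
  where
  T+2<T+z+1 : suc (suc T) < suc (T + z)
  T+2<T+z+1 = s≤s (subst (_≤ T + z) (+-comm T 2) (+-monoʳ-≤ T 2≤z))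

coreArms-filter : ∀ {p} {P : ℕ → Set p} (P? : Decidable P) {t a} → CoreArms t a → CoreArms t (filter P? a)
coreArms-filter P? {a = []}    _ = tt
coreArms-filter P? {a = x ∷ a} (x<t , avoid ∷ avoids , c) with does (P? x)
... | true  = x<t , avoid ∷ All.filter⁺ P? avoids , coreArms-filter P? c
... | false = coreArms-filter P? c

hookSum-drop<2 : ∀ {a} → Gapped a → hookSum a ≤ hookSum (filter (2 ≤?_) a) + 3
hookSum-drop<2 {[]}                _                  = z≤n
hookSum-drop<2 {zero ∷ []}         _                  = s≤s z≤n
hookSum-drop<2 {suc zero ∷ []}     _                  = ≤-refl
hookSum-drop<2 {zero ∷ _ ∷ _}      ((() ∷ _) ∷ _)
hookSum-drop<2 {suc zero ∷ _ ∷ _}  ((s≤s () ∷ _) ∷ _)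
hookSum-drop<2 {suc (suc x) ∷ a}   (_ ∷ g)            =
  subst (hookSum (suc (suc x) ∷ a) ≤_) (sym (+-assoc (armHook (2 + x)) (hookSum (filter (2 ≤?_) a)) 3))
        (+-monoʳ-≤ (armHook (2 + x)) (hookSum-drop<2 g))

hookSum-drop0 : ∀ {a} → Gapped a → hookSum a ≤ hookSum (filter (1 ≤?_) a) + 1
hookSum-drop0 {[]}            _              = z≤n
hookSum-drop0 {zero ∷ []}     _              = ≤-refl
hookSum-drop0 {zero ∷ _ ∷ _}  ((() ∷ _) ∷ _)
hookSum-drop0 {suc x ∷ a}     (_ ∷ g)        =
  subst (hookSum (suc x ∷ a) ≤_) (sym (+-assoc (armHook (suc x)) (hookSum (filter (1 ≤?_) a)) 1))
        (+-monoʳ-≤ (armHook (suc x)) (hookSum-drop0 g))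

add-top-arm : ∀ {m a} → Gapped a → CoreArms (3 + m) a → All (_< suc m) a →
              ∃[ b ] (Gapped b × CoreArms (3 + m) b × hookSum a < hookSum b)
add-top-arm {m} {a} g c a<m+1 =
  T ∷ filter (2 ≤?_) a ,
  All.filter⁺ (2 ≤?_) (All.map (λ z<m+1 → s≤s (s≤s (s≤s⁻¹ z<m+1))) a<m+1) ∷ AllPairs.filter⁺ (2 ≤?_) g ,
  (≤-refl , All.map avoids-large (2≤T ∷ all-filter (2 ≤?_) a) , coreArms-filter (2 ≤?_) c) ,
  ≤-<-trans (hookSum-drop<2 g) (subst (_< hookSum (T ∷ filter (2 ≤?_) a)) (+-comm 3 _) (+-monoˡ-< _ 3<armHook-T))
  where
  T = 2 + m
  2≤T : 2 ≤ T
  2≤T = s≤s (s≤s z≤n)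
  3<armHook-T : 3 < armHook T
  3<armHook-T = s≤s (s≤s (s≤s (≤-trans (s≤s z≤n) (m≤n+m (2 + m) m))))

replace-arm : ∀ {m r} → Gapped (suc m ∷ r) → CoreArms (3 + m) (suc m ∷ r) →
              ∃[ b ] (Gapped b × CoreArms (3 + m) b × hookSum (suc m ∷ r) < hookSum b)
replace-arm {m} {r} (gaps ∷ g) (_ , _ ∷ avoids , c) =
  T ∷ filter (1 ≤?_) r ,
  All.filter⁺ (1 ≤?_) (All.map (λ 2+z≤m+1 → ≤-trans 2+z≤m+1 (n≤1+n (suc m))) gaps) ∷
    AllPairs.filter⁺ (1 ≤?_) g ,
  (≤-refl ,
   avoids-large (s≤s (s≤s z≤n)) ∷ All.zipWith avoids-T (all-filter (1 ≤?_) r , All.filter⁺ (1 ≤?_) avoids) ,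
   coreArms-filter (1 ≤?_) c) ,
  ≤-<-trans (+-monoʳ-≤ (armHook (suc m)) (hookSum-drop0 g)) (≤-reflexive (armHook-gain m (hookSum (filter (1 ≤?_) r))))
  where
  T = 2 + m
  avoids-T : ∀ {z} → 1 ≤ z × Avoids (3 + m) (suc (suc m + z)) → Avoids (3 + m) (suc (T + z))
  avoids-T {suc zero}    (_ , m+3≢t , _) = contradiction (cong (2 +_) (+-comm m 1)) m+3≢t
  avoids-T {suc (suc z)} _               = avoids-large (s≤s (s≤s z≤n))
  armHook-gain : ∀ m k → suc (suc (suc m + suc m) + (k + 1)) ≡ suc ((2 + m) + (2 + m)) + k
  armHook-gain = solve-∀

enlarge : ∀ {m a} → Gapped a → CoreArms (3 + m) a → 2 + m ∉ a →
          ∃[ b ] (Gapped b × CoreArms (3 + m) b × hookSum a < hookSum b)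
enlarge {a = []}    g c _ = add-top-arm g c []
enlarge {a = x ∷ r} g c@(x<t , _) T∉a with m≤n⇒m<n∨m≡n (s≤s⁻¹ x<t)
... | inj₂ refl = contradiction (here refl) T∉a
... | inj₁ x<T with m≤n⇒m<n∨m≡n (s≤s⁻¹ x<T)
...   | inj₁ x<m+1 = add-top-arm g c (width≤⇒all< (gapped⇒strict g) x<m+1)
...   | inj₂ refl  = replace-arm g c

maximal⇒top-arm : ∀ {m a} → Gapped a → CoreArms (3 + m) a →
                  (∀ {b} → Gapped b → CoreArms (3 + m) b → hookSum b ≤ hookSum a) → ∃[ r ] (a ≡ (2 + m) ∷ r)
maximal⇒top-arm {m} {a} g c maximal with 2 + m ∈? a
... | no T∉a with _ , g′ , c′ , a<b ← enlarge g c T∉a = contradiction (maximal g′ c′) (<⇒≱ a<b)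
maximal⇒top-arm {a = _ ∷ r} _ _ _ | yes (here refl)  = r , refl
maximal⇒top-arm {a = _ ∷ _} g (x<t , _) _ | yes (there T∈r) =
  contradiction (s≤s⁻¹ x<t) (<⇒≱ (All.lookup (AllPairs.head (gapped⇒strict g)) T∈r))

top-arm-excludes : ∀ {m r} → Gapped ((2 + m) ∷ r) → CoreArms (3 + m) ((2 + m) ∷ r) →
                   0 ∉ (2 + m) ∷ r × 1 ∉ (2 + m) ∷ r × suc m ∉ (2 + m) ∷ r
top-arm-excludes {m} (gaps ∷ _) (_ , _ ∷ avoids , _) =
  (λ { (here ()) ; (there 0∈r) → proj₁ (All.lookup avoids 0∈r) (cong (3 +_) (+-identityʳ m)) }) ,
  (λ { (here ()) ; (there 1∈r) → proj₂ (All.lookup avoids 1∈r) (cong (3 +_) (+-comm m 1)) }) ,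
  (λ { (here m+1≡m+2) → <⇒≢ (n<1+n (suc m)) m+1≡m+2
     ; (there m+1∈r)   → 1+n≰n (s≤s⁻¹ (All.lookup gaps m+1∈r)) })

lemma3p1 : (t : ℕ) → 3 ≤ t → (λ′ : List ℕ) → InDS t λ′
    → (∀ μ → InDS t μ → size μ ≤ size λ′)
    → InMD λ′ (2 * t ∸ 1) × ¬ InMD λ′ 1 × ¬ InMD λ′ 3 × ¬ InMD λ′ (2 * t ∸ 3)
lemma3p1 t@(suc (suc (suc m))) (s≤s (s≤s (s≤s z≤n))) _ ds maximal
  with a , g , c , refl ← InDS⇒fromArms z<s ds
  with r , refl ← maximal⇒top-arm g c (λ {b} g′ c′ →
         subst₂ _≤_ (size-fromArms (gapped⇒strict g′)) (size-fromArms (gapped⇒strict g))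
                    (maximal (fromArms b) (fromArms-InDS g′ c′)))
  with no-0 , no-1 , no-m+1 ← top-arm-excludes g c =
  subst (InMD (fromArms a)) armHook-top (InMD-fromArms⁺ s (here refl)) ,
  no-0 ∘ InMD-fromArms⁻ s ,
  no-1 ∘ InMD-fromArms⁻ s ,
  no-m+1 ∘ InMD-fromArms⁻ s ∘ subst (InMD (fromArms a)) (sym armHook-below-top)
  where
  s = gapped⇒strict g
  armHook-top : armHook (2 + m) ≡ 2 * t ∸ 1
  armHook-top = solve-top m
    where
    solve-top : ∀ m → suc ((2 + m) + (2 + m)) ≡ (2 + m) + ((3 + m) + 0)
    solve-top = solve-∀
  armHook-below-top : armHook (suc m) ≡ 2 * t ∸ 3
  armHook-below-top = solve-below m
    where
    solve-below : ∀ m → suc (suc m + suc m) ≡ m + ((3 + m) + 0)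
    solve-below = solve-∀
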